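{- Let $n\ge2$ and for $1\le j\le n$ let $\alpha_j\in\mathbb Z$, $\beta_j\in\mathbb N$ with $\gcd(\alpha_j,\beta_j)=1$, $\beta_j\nmid\alpha_j$, $\beta_j\nmid2\alpha_j$, and $\frac{\alpha_r}{\beta_r}\pm\frac{\alpha_s}{\beta_s}\notin\mathbb Z$ for $r\ne s$; let $\boldsymbol{\zeta_n}=(e(\alpha_1/\beta_1),\dots,e(\alpha_n/\beta_n))$. Let $h\in\mathbb Z$, $k\in\mathbb N$ with $\gcd(h,k)=1$. Then all summands of the multi-sum defining $R_n(\boldsymbol{\zeta_n};\zeta_k^h)$ are finite if and only if $\beta_j\nmid k$ for all $1\le j\le n$.
   Context: $e(x)=e^{2\pi ix}$, $\zeta_k^h=e(h/k)$, $(a;q)_m=\prod_{i=1}^m(1-aq^{i-1})$. For $\boldsymbol x=(x_1,\dots,x_n)$, \[R_n(\boldsymbol x;q)=\sum_{\substack{m_1>0\\ m_2,\dots,m_n\ge0}}\frac{q^{(m_1+\cdots+m_n)^2+(m_1+\cdots+m_{n-1})+(m_1+\cdots+m_{n-2})+\cdots+m_1}}{(x_1q;q)_{m_1}(q/x_1;q)_{m_1}\prod_{i=2}^n(x_iq^{m_1+\cdots+m_{i-1}};q)_{m_i+1}(q^{m_1+\cdots+m_{i-1}}/x_i;q)_{m_i+1}}.\] -}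

module Defs where

open import Data.Nat as ℕ using (ℕ; zero; suc; NonZero; _≤_; _<_)
open import Data.Integer as ℤ using (ℤ; +_)
open import Data.Rational using (ℚ; _/_; _+_; _*_; -_)
open import Data.Fin using (Fin; zero; suc; toℕ)
open import Data.Product using (∃; _×_)
open import Relation.Binary.PropositionalEquality using (_≡_)
open import Relation.Nullary using (¬_)
open import Function using (_∘_)

-- We represent the root of unity e(θ) (θ ∈ ℚ) by its exponent θ.
-- e(θ) = 1  iff  θ ∈ ℤ.
IsInteger : ℚ → Set
IsInteger θ = ∃ λ (z : ℤ) → θ ≡ z / 1

NonVanishing : ℚ → Set
NonVanishing θ = ¬ IsInteger θ

ℕ→ℚ : ℕ → ℚ
ℕ→ℚ t = (+ t) / 1

-- prefixSum m j = m_1 + ... + m_{j} for the 0-based index j (i.e. sum of m i with i < j)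
prefixSum : ∀ {n} → (Fin n → ℕ) → Fin n → ℕ
prefixSum m zero    = 0
prefixSum m (suc j) = m zero ℕ.+ prefixSum (m ∘ suc) j

-- lower bound of the running index i of the factors of the j-th pair of
-- q-Pochhammer symbols (0-based j):
--   j = 0 : (x_1 q;q)_{m_1}(q/x_1;q)_{m_1}  has factors  1 - x_1^{±1} q^i ,  1 ≤ i ≤ m_1
--   j ≥ 1 : (x_j q^{M};q)_{m_j+1}(q^{M}/x_j;q)_{m_j+1}, M = m_1+...+m_{j-1},
--           has factors 1 - x_j^{±1} q^{M+i} , 0 ≤ i ≤ m_j
lowerIdx : ∀ {n} → Fin n → ℕ
lowerIdx zero    = 1
lowerIdx (suc _) = 0

InDomain : ∀ {n} → (Fin n → ℕ) → Set
InDomain {n} m = ∀ (j : Fin n) → toℕ j ≡ 0 → 0 < m j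

-- Summand of R_n(x; q) indexed by m is finite, where x_j = e(a_j) and q = e(c):
-- every factor 1 - x_j^{±1} q^t of the denominator is nonzero (the numerator
-- is a power of the root of unity q, hence always finite).
SummandFinite : ∀ {n} → (a : Fin n → ℚ) → (c : ℚ) → (Fin n → ℕ) → Set
SummandFinite {n} a c m =
  ∀ (j : Fin n) (i : ℕ) → lowerIdx j ≤ i → i ≤ m j →
    NonVanishing (a j + ℕ→ℚ (prefixSum m j ℕ.+ i) * c)
    × NonVanishing ((- a j) + ℕ→ℚ (prefixSum m j ℕ.+ i) * c)

AllSummandsFinite : ∀ {n} → (a : Fin n → ℚ) → (c : ℚ) → Set
AllSummandsFinite {n} a c = ∀ (m : Fin n → ℕ) → InDomain m → SummandFinite a c m

{-# OPTIONS --safe #-}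
module Submission where

-- A factor 1 - e(±α/β + t h/k) of a summand vanishes iff βk divides ±αk + thβ. Then β
-- divides αk, hence k, as gcd(α, β) = 1; so if β_j ∤ k for all j no factor vanishes.
-- Conversely, if k = dβ_j then, h being invertible modulo k, some t ≥ 1 satisfies
-- th ≡ -α_j d (mod k), i.e. α_j/β_j + th/k ∈ ℤ, and the summand at m = (t, 0, …, 0)
-- contains the vanishing factor 1 - x_j q^t.

open import Defs
open import Data.Nat as ℕ using (ℕ; NonZero; _≤_)
open import Data.Nat.Divisibility as ℕD using ()
open import Data.Integer as ℤ using (ℤ; +_)
open import Data.Integer.Divisibility as ℤD using ()
open import Data.Integer.GCD as ℤG using ()
open import Data.Rational using (ℚ; _/_; _+_; _-_)
open import Data.Fin using (Fin)
open import Data.Product using (_×_)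
open import Function.Bundles using (_⇔_)
open import Relation.Binary.PropositionalEquality using (_≡_; _≢_)
open import Relation.Nullary using (¬_)

open import Data.Nat using (suc; z≤n; s≤s)
import Data.Nat.Properties as ℕP
import Data.Nat.Coprimality as ℕC
open import Data.Nat.GCD using (module Bézout)
open import Data.Integer using (-[1+_]; _%ℕ_; _/ℕ_)
import Data.Integer.Properties as ℤP
open import Data.Integer.DivMod using (a≡a%ℕn+[a/ℕn]*n)
open import Data.Integer.Divisibility.Signed
  using (_∣_; divides; ∣ᵤ⇒∣; ∣⇒∣ᵤ; ∣-refl; ∣-trans; ∣m∣n⇒∣m-n; ∣m+n∣n⇒∣m; ∣n⇒∣m*n; ∣m⇒∣m*n; *-monoˡ-∣)
open import Data.Integer.Coprimality as ℤC using (Coprime)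
open import Data.Integer.Tactic.RingSolver using (solve-∀)
open import Data.Rational using (_*_; -_; toℚᵘ)
import Data.Rational.Properties as ℚP
open import Data.Rational.Unnormalised as ℚᵘ using (mkℚᵘ; *≡*)
import Data.Rational.Unnormalised.Properties as ℚᵘP
open import Data.Fin using () renaming (zero to fzero; suc to fsuc)
open import Data.Product using (∃; _,_; proj₁)
open import Function.Base using (_∘_)
open import Function.Bundles using (mk⇔; Equivalence)
open import Relation.Binary.PropositionalEquality
  using (refl; sym; trans; cong; cong₂; subst; subst₂; module ≡-Reasoning)

toℚᵘ-/ : ∀ i m .{{_ : NonZero m}} → toℚᵘ (i / m) ℚᵘ.≃ i ℚᵘ./ m
toℚᵘ-/ i (suc m) = ℚP.toℚᵘ-fromℚᵘ (mkℚᵘ i m)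

/-+-/ : ∀ i m j n .{{_ : NonZero m}} .{{_ : NonZero n}} →
        i / m + j / n ≡ _/_ (i ℤ.* + n ℤ.+ j ℤ.* + m) (m ℕ.* n) {{ℕP.m*n≢0 m n}}
/-+-/ i m@(suc _) j n@(suc _) = ℚP.toℚᵘ-injective (begin
  toℚᵘ (i / m + j / n)                          ≈⟨ ℚP.toℚᵘ-homo-+ (i / m) (j / n) ⟩
  toℚᵘ (i / m) ℚᵘ.+ toℚᵘ (j / n)                ≈⟨ ℚᵘP.+-cong (toℚᵘ-/ i m) (toℚᵘ-/ j n) ⟩
  i ℚᵘ./ m ℚᵘ.+ j ℚᵘ./ n                        ≈⟨ toℚᵘ-/ (i ℤ.* + n ℤ.+ j ℤ.* + m) (m ℕ.* n) ⟨
  toℚᵘ ((i ℤ.* + n ℤ.+ j ℤ.* + m) / (m ℕ.* n))  ∎)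
  where open ℚᵘP.≃-Reasoning

/-*-/ : ∀ i m j n .{{_ : NonZero m}} .{{_ : NonZero n}} →
        (i / m) * (j / n) ≡ _/_ (i ℤ.* j) (m ℕ.* n) {{ℕP.m*n≢0 m n}}
/-*-/ i m@(suc _) j n@(suc _) = ℚP.toℚᵘ-injective (begin
  toℚᵘ (i / m * (j / n))          ≈⟨ ℚP.toℚᵘ-homo-* (i / m) (j / n) ⟩
  toℚᵘ (i / m) ℚᵘ.* toℚᵘ (j / n)  ≈⟨ ℚᵘP.*-cong (toℚᵘ-/ i m) (toℚᵘ-/ j n) ⟩
  i ℚᵘ./ m ℚᵘ.* (j ℚᵘ./ n)        ≈⟨ toℚᵘ-/ (i ℤ.* j) (m ℕ.* n) ⟨
  toℚᵘ ((i ℤ.* j) / (m ℕ.* n))    ∎)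
  where open ℚᵘP.≃-Reasoning

neg-/ : ∀ i m .{{_ : NonZero m}} → - (i / m) ≡ (ℤ.- i) / m
neg-/ i m@(suc _) = ℚP.toℚᵘ-injective (begin
  toℚᵘ (- (i / m))    ≈⟨ ℚP.toℚᵘ-homo‿- (i / m) ⟩
  ℚᵘ.- toℚᵘ (i / m)   ≈⟨ ℚᵘP.-‿cong (toℚᵘ-/ i m) ⟩
  (ℤ.- i) ℚᵘ./ m      ≈⟨ toℚᵘ-/ (ℤ.- i) m ⟨
  toℚᵘ ((ℤ.- i) / m)  ∎)
  where open ℚᵘP.≃-Reasoning

ℕ→ℚ-*-/ : ∀ t j n .{{_ : NonZero n}} → ℕ→ℚ t * (j / n) ≡ (+ t ℤ.* j) / n
ℕ→ℚ-*-/ t j n = trans (/-*-/ (+ t) 1 j n)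
  (ℚP./-cong {+ t ℤ.* j} {1 ℕ.* n} {{ℕP.m*n≢0 1 n}} refl (ℕP.*-identityˡ n))

/-+-ℕ→ℚ*-/ : ∀ i m t j n .{{_ : NonZero m}} .{{_ : NonZero n}} →
             i / m + ℕ→ℚ t * (j / n) ≡ _/_ (i ℤ.* + n ℤ.+ + t ℤ.* j ℤ.* + m) (m ℕ.* n) {{ℕP.m*n≢0 m n}}
/-+-ℕ→ℚ*-/ i m t j n = trans (cong (λ x → i / m + x) (ℕ→ℚ-*-/ t j n)) (/-+-/ i m (+ t ℤ.* j) n)

isInteger-/⇔∣ : ∀ i m .{{_ : NonZero m}} → IsInteger (i / m) ⇔ + m ∣ i
isInteger-/⇔∣ i m@(suc m-1) = mk⇔ to from
  where
  to : IsInteger (i / m) → + m ∣ i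
  to (z , i/m≡z) = divides z (trans (sym (ℤP.*-identityʳ i))
    (ℚᵘP.drop-*≡* (ℚP./-injective-≃ (mkℚᵘ i m-1) (mkℚᵘ z 0) i/m≡z)))
  from : + m ∣ i → IsInteger (i / m)
  from (divides z i≡z*m) = z , ℚP.fromℚᵘ-cong {mkℚᵘ i m-1} {mkℚᵘ z 0} (*≡* (trans (ℤP.*-identityʳ i) i≡z*m))

isInteger-shift⇔∣ : ∀ i m t j n .{{_ : NonZero m}} .{{_ : NonZero n}} →
                    IsInteger (i / m + ℕ→ℚ t * (j / n)) ⇔ + (m ℕ.* n) ∣ i ℤ.* + n ℤ.+ + t ℤ.* j ℤ.* + m
isInteger-shift⇔∣ i m t j n =
  subst (λ x → IsInteger x ⇔ + (m ℕ.* n) ∣ N) (sym (/-+-ℕ→ℚ*-/ i m t j n))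
    (isInteger-/⇔∣ N (m ℕ.* n) {{ℕP.m*n≢0 m n}})
  where N = i ℤ.* + n ℤ.+ + t ℤ.* j ℤ.* + m

gcd≡1⇒coprime : ∀ i j → ℤG.gcd i j ≡ + 1 → Coprime i j
gcd≡1⇒coprime _ _ = ℕC.gcd≡1⇒coprime ∘ ℤP.+-injective

coprime-neg : ∀ i j → Coprime i j → Coprime (ℤ.- i) j
coprime-neg i _ = subst (λ x → ℕC.Coprime x _) (sym (ℤP.∣-i∣≡∣i∣ i))

pos-1+*≡* : ∀ a b c d → 1 ℕ.+ a ℕ.* b ≡ c ℕ.* d → + 1 ℤ.+ + a ℤ.* + b ≡ + c ℤ.* + d
pos-1+*≡* a b c d eq = begin
  + 1 ℤ.+ + a ℤ.* + b  ≡⟨ cong (ℤ._+_ (+ 1)) (ℤP.pos-* a b) ⟨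
  + (1 ℕ.+ a ℕ.* b)    ≡⟨ cong +_ eq ⟩
  + (c ℕ.* d)          ≡⟨ ℤP.pos-* c d ⟩
  + c ℤ.* + d          ∎
  where open ≡-Reasoning

ℕ-modular-inverse : ∀ {m n} → ℕC.Coprime m n → ∃ λ u → + n ∣ u ℤ.* + m ℤ.- + 1
ℕ-modular-inverse {m} {n} coprime with ℕC.coprime-Bézout coprime
... | Bézout.+- x y 1+yn≡xm = + x , divides (+ y) (begin
  + x ℤ.* + m ℤ.- + 1              ≡⟨ cong (ℤ._- + 1) (pos-1+*≡* y n x m 1+yn≡xm) ⟨
  + 1 ℤ.+ + y ℤ.* + n ℤ.- + 1      ≡⟨ cancel-1 (+ y ℤ.* + n) ⟩
  + y ℤ.* + n                      ∎)
  where
  open ≡-Reasoning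
  cancel-1 : ∀ a → + 1 ℤ.+ a ℤ.- + 1 ≡ a
  cancel-1 = solve-∀
... | Bézout.-+ x y 1+xm≡yn = ℤ.- + x , divides (ℤ.- + y) (begin
  ℤ.- + x ℤ.* + m ℤ.- + 1          ≡⟨ negate (+ x) (+ m) ⟩
  ℤ.- (+ 1 ℤ.+ + x ℤ.* + m)        ≡⟨ cong ℤ.-_ (pos-1+*≡* x m y n 1+xm≡yn) ⟩
  ℤ.- (+ y ℤ.* + n)                ≡⟨ ℤP.neg-distribˡ-* (+ y) (+ n) ⟩
  ℤ.- + y ℤ.* + n                  ∎)
  where
  open ≡-Reasoning
  negate : ∀ a b → ℤ.- a ℤ.* b ℤ.- + 1 ≡ ℤ.- (+ 1 ℤ.+ a ℤ.* b)
  negate = solve-∀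

modular-inverse : ∀ j n → Coprime j (+ n) → ∃ λ u → + n ∣ u ℤ.* j ℤ.- + 1
modular-inverse (+ m)    n coprime = ℕ-modular-inverse coprime
modular-inverse -[1+ m ] n coprime =
  let u , n∣um-1 = ℕ-modular-inverse coprime
  in ℤ.- u , subst (λ v → + n ∣ v ℤ.- + 1) (neg-*-neg u (+ suc m)) n∣um-1
  where
  neg-*-neg : ∀ a b → a ℤ.* b ≡ ℤ.- a ℤ.* ℤ.- b
  neg-*-neg = solve-∀

positive-representative : ∀ x n .{{_ : NonZero n}} → ∃ λ t → 1 ≤ t × + n ∣ + t ℤ.- x
positive-representative x n@(suc _) = n ℕ.+ x %ℕ n , s≤s z≤n , divides (+ 1 ℤ.- x /ℕ n) (begin
  + (n ℕ.+ x %ℕ n) ℤ.- x                                ≡⟨ cong₂ ℤ._-_ (ℤP.pos-+ n (x %ℕ n)) (a≡a%ℕn+[a/ℕn]*n x n) ⟩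
  + n ℤ.+ + (x %ℕ n) ℤ.- (+ (x %ℕ n) ℤ.+ x /ℕ n ℤ.* + n)  ≡⟨ cancel (+ n) (+ (x %ℕ n)) (x /ℕ n) ⟩
  (+ 1 ℤ.- x /ℕ n) ℤ.* + n                               ∎)
  where
  open ≡-Reasoning
  cancel : ∀ a r q → a ℤ.+ r ℤ.- (r ℤ.+ q ℤ.* a) ≡ (+ 1 ℤ.- q) ℤ.* a
  cancel = solve-∀

-- With u an inverse of j mod n, any t ≡ - c u (mod n) solves c + t j ≡ 0 (mod n).
linear-congruence-solvable : ∀ c j n .{{_ : NonZero n}} → Coprime j (+ n) →
                             ∃ λ t → 1 ≤ t × + n ∣ c ℤ.+ + t ℤ.* j
linear-congruence-solvable c j n coprime =
  let u , n∣uj-1    = modular-inverse j n coprime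
      t , 1≤t , n∣t+cu = positive-representative (ℤ.- (c ℤ.* u)) n
  in t , 1≤t , subst (+ n ∣_) (sym (split c (+ t) j u))
                 (∣m∣n⇒∣m-n (∣m⇒∣m*n j n∣t+cu) (∣n⇒∣m*n c n∣uj-1))
  where
  split : ∀ c t j u → c ℤ.+ t ℤ.* j ≡ (t ℤ.- ℤ.- (c ℤ.* u)) ℤ.* j ℤ.- c ℤ.* (u ℤ.* j ℤ.- + 1)
  split = solve-∀

isInteger-shift⇒∣ : ∀ i m t j n .{{_ : NonZero m}} .{{_ : NonZero n}} → Coprime i (+ m) →
                   IsInteger (i / m + ℕ→ℚ t * (j / n)) → m ℕD.∣ n
isInteger-shift⇒∣ i m t j n coprime integral =
  ℤC.coprime-divisor (+ m) i (+ n) (ℤC.sym {i} {+ m} coprime) (∣⇒∣ᵤ m∣i*n)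
  where
  mn∣ : + (m ℕ.* n) ∣ i ℤ.* + n ℤ.+ + t ℤ.* j ℤ.* + m
  mn∣ = Equivalence.to (isInteger-shift⇔∣ i m t j n) integral
  m∣i*n : + m ∣ i ℤ.* + n
  m∣i*n = ∣m+n∣n⇒∣m (∣-trans (∣ᵤ⇒∣ (ℕD.m∣m*n n)) mn∣) (∣n⇒∣m*n (+ t ℤ.* j) ∣-refl)

∣⇒isInteger-shift : ∀ i m j n .{{_ : NonZero m}} .{{_ : NonZero n}} → Coprime j (+ n) → m ℕD.∣ n →
                   ∃ λ t → 1 ≤ t × IsInteger (i / m + ℕ→ℚ t * (j / n))
∣⇒isInteger-shift i m j n coprime (ℕD.divides d refl) =
  let t , 1≤t , n∣id+tj = linear-congruence-solvable (i ℤ.* + d) j n coprime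
  in t , 1≤t , Equivalence.from (isInteger-shift⇔∣ i m t j n)
                 (subst₂ _∣_ nm≡mn (scale t) (*-monoˡ-∣ (+ m) n∣id+tj))
  where
  open ≡-Reasoning
  nm≡mn : + n ℤ.* + m ≡ + (m ℕ.* n)
  nm≡mn = trans (ℤP.*-comm (+ n) (+ m)) (sym (ℤP.pos-* m n))
  scale : ∀ t → (i ℤ.* + d ℤ.+ + t ℤ.* j) ℤ.* + m ≡ i ℤ.* + n ℤ.+ + t ℤ.* j ℤ.* + m
  scale t = begin
    (i ℤ.* + d ℤ.+ + t ℤ.* j) ℤ.* + m      ≡⟨ distrib i (+ d) (+ t ℤ.* j) (+ m) ⟩
    i ℤ.* (+ d ℤ.* + m) ℤ.+ + t ℤ.* j ℤ.* + m ≡⟨ cong (λ e → i ℤ.* e ℤ.+ + t ℤ.* j ℤ.* + m) (ℤP.pos-* d m) ⟨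
    i ℤ.* + n ℤ.+ + t ℤ.* j ℤ.* + m        ∎
    where
    distrib : ∀ i d e m → (i ℤ.* d ℤ.+ e) ℤ.* m ≡ i ℤ.* (d ℤ.* m) ℤ.+ e ℤ.* m
    distrib = solve-∀

firstOnly : ∀ {n} → ℕ → Fin n → ℕ
firstOnly t fzero    = t
firstOnly t (fsuc _) = 0

firstOnly-inDomain : ∀ {n t} → 1 ≤ t → InDomain {n} (firstOnly t)
firstOnly-inDomain 1≤t fzero    _  = 1≤t
firstOnly-inDomain 1≤t (fsuc _) ()

prefixSum-zeros : ∀ {n} (j : Fin n) → prefixSum (λ _ → 0) j ≡ 0
prefixSum-zeros fzero    = refl
prefixSum-zeros (fsuc j) = prefixSum-zeros j

prefixSum-firstOnly : ∀ {n} t (j : Fin n) → prefixSum (firstOnly t) (fsuc j) ≡ t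
prefixSum-firstOnly t j = trans (cong (t ℕ.+_) (prefixSum-zeros j)) (ℕP.+-identityʳ t)

-- In the summand at m = (t, 0, …, 0), 1 - x_j q^t is the last factor for j = 1
-- and the first one for j ≥ 2.
allSummandsFinite⇒nonVanishing : ∀ {n} (a : Fin n → ℚ) c → AllSummandsFinite a c →
                                 ∀ j t → 1 ≤ t → NonVanishing (a j + ℕ→ℚ t * c)
allSummandsFinite⇒nonVanishing _ _ finite fzero t 1≤t =
  proj₁ (finite (firstOnly t) (firstOnly-inDomain 1≤t) fzero t 1≤t ℕP.≤-refl)
allSummandsFinite⇒nonVanishing a c finite (fsuc j) t 1≤t =
  subst (λ s → NonVanishing (a (fsuc j) + ℕ→ℚ s * c))
    (trans (ℕP.+-identityʳ _) (prefixSum-firstOnly t j))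
    (proj₁ (finite (firstOnly t) (firstOnly-inDomain 1≤t) (fsuc j) 0 z≤n z≤n))

lemma3p1 : (n : ℕ) → 2 ≤ n →
    (α : Fin n → ℤ) (β : Fin n → ℕ) (βnz : ∀ j → NonZero (β j)) →
    (∀ j → ℤG.gcd (α j) (+ β j) ≡ + 1) →
    (∀ j → ¬ ((+ β j) ℤD.∣ α j)) →
    (∀ j → ¬ ((+ β j) ℤD.∣ (+ 2 ℤ.* α j))) →
    (∀ r s → r ≢ s →
      ¬ IsInteger (_/_ (α r) (β r) {{βnz r}} + _/_ (α s) (β s) {{βnz s}})
      × ¬ IsInteger (_/_ (α r) (β r) {{βnz r}} - _/_ (α s) (β s) {{βnz s}})) →
    (h : ℤ) (k : ℕ) (knz : NonZero k) →
    ℤG.gcd h (+ k) ≡ + 1 →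
    AllSummandsFinite (λ j → _/_ (α j) (β j) {{βnz j}}) (_/_ h k {{knz}})
      ⇔ (∀ j → ¬ (β j ℕD.∣ k))
lemma3p1 _ _ α β βnz α⊥β _ _ _ h k knz h⊥k = mk⇔ finite⇒β∤k β∤k⇒finite
  where
  instance
    β-nonZero : ∀ {j} → NonZero (β j)
    β-nonZero {j} = βnz j
    k-nonZero : NonZero k
    k-nonZero = knz

  finite⇒β∤k : AllSummandsFinite (λ j → α j / β j) (h / k) → ∀ j → ¬ (β j ℕD.∣ k)
  finite⇒β∤k finite j β∣k =
    let t , 1≤t , integral = ∣⇒isInteger-shift (α j) (β j) h k (gcd≡1⇒coprime h (+ k) h⊥k) β∣k
    in allSummandsFinite⇒nonVanishing (λ j → α j / β j) (h / k) finite j t 1≤t integral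

  β∤k⇒finite : (∀ j → ¬ (β j ℕD.∣ k)) → AllSummandsFinite (λ j → α j / β j) (h / k)
  β∤k⇒finite β∤k m _ j i _ _ =
      β∤k j ∘ isInteger-shift⇒∣ (α j) (β j) t h k α⊥β'
    , β∤k j ∘ isInteger-shift⇒∣ (ℤ.- α j) (β j) t h k (coprime-neg (α j) (+ β j) α⊥β')
            ∘ subst (λ x → IsInteger (x + ℕ→ℚ t * (h / k))) (neg-/ (α j) (β j))
    where
    t = prefixSum m j ℕ.+ i
    α⊥β' = gcd≡1⇒coprime (α j) (+ β j) (α⊥β j)
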